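{- Let $V=\{1,\dots,n\}$. The number of reachable states $(S,\delta)$ is $\mathcal{O}^*(4^n)$.
   Context: A state is a pair $(S,\delta)$ with $S\subseteq V$, $1\in S$, and $\delta=\{\delta_v\}_{v\in S}$ a sequence of nonnegative integers. Define $\mathsf{lastRmvd}(S)=\max(\{0,1,\dots,n\}\setminus S)$ and $\mathsf{bad}(S,\delta)=\{v\in S : v<\mathsf{lastRmvd}(S),\ \delta_v=0\}$. A state $(S,\delta)$ is reachable if (i) $\delta_1\ge 1$, (ii) $\sum_{v\in S}\delta_v=|S|-1$, and (iii) $|\mathsf{bad}(S,\delta)|\le 1$. The notation $\mathcal{O}^*(\cdot)$ hides factors polynomial in $n$. -}

module Defs where

open import Data.Nat using (ℕ; zero; suc; _+_; _*_; _∸_; _^_; _≤_; _<_; _⊔_)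
open import Data.Bool using (Bool; true; false; if_then_else_)
open import Data.Fin using (Fin; toℕ)
open import Data.Fin.Subset using (Subset; ∣_∣)
open import Data.Vec using (Vec; lookup)
open import Data.List using (List; map; foldr; allFin)
open import Data.Nat.ListAction using (sum)
open import Data.Product using (_×_; proj₁; proj₂)
open import Relation.Binary.PropositionalEquality using (_≡_)

-- Vertex set V = {1,…,n}; the element v : Fin n stands for vertex (toℕ v + 1).
label : {n : ℕ} → Fin n → ℕ
label v = suc (toℕ v)

-- A state (S, δ): S ⊆ V as a bit vector, δ as a vector of naturals.
-- δ is only meaningful on S; to make states with the same (S, δ|_S) equal
-- we normalise by requiring δ_v = 0 for v ∉ S (see Reachable).
State : ℕ → Set
State n = Subset n × Vec ℕ n

-- lastRmvd(S) = max({0,1,…,n} \ S)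
lastRmvd : {n : ℕ} → Subset n → ℕ
lastRmvd {n} S =
  foldr _⊔_ 0 (map (λ v → if lookup S v then 0 else label v) (allFin n))

sumOn : {n : ℕ} → Subset n → Vec ℕ n → ℕ
sumOn {n} S δ = sum (map (λ v → if lookup S v then lookup δ v else 0) (allFin n))

IsBad : {n : ℕ} → Subset n → Vec ℕ n → Fin n → Set
IsBad S δ v = (lookup S v ≡ true) × (label v < lastRmvd S) × (lookup δ v ≡ 0)

record Reachable (n : ℕ) (st : State n) : Set where
  field
    -- well-formedness of the representation: δ is supported on S
    δ-outside : (v : Fin n) → lookup (proj₁ st) v ≡ false → lookup (proj₂ st) v ≡ 0
    one : Fin n
    one-is-1 : label one ≡ 1
    one∈S : lookup (proj₁ st) one ≡ true
    δ₁≥1 : 1 ≤ lookup (proj₂ st) one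
    sumδ : sumOn (proj₁ st) (proj₂ st) ≡ ∣ proj₁ st ∣ ∸ 1
    bad≤1 : (u w : Fin n) → IsBad (proj₁ st) (proj₂ st) u → IsBad (proj₁ st) (proj₂ st) w → u ≡ w

module Submission where

-- A reachable state (S, δ) is determined by its code
--     (lastRmvd S , the bad vertex of (S, δ) if there is one , δ) :
-- a vertex v lies in S iff v > lastRmvd S, or v < lastRmvd S and either
-- δ_v > 0 (δ vanishes outside S) or v is the bad vertex (condition (iii)
-- says it is the only vertex of S below lastRmvd S with δ_v = 0).
-- The first component ranges over {0,…,n}, the second over n + 1 values,
-- and δ is a vector of n naturals with Σ δ = |S| - 1 ≤ n; there are at
-- most 2^(n+n) = 4^n such vectors.  Hence there are at most (n+1)² 4^n
-- reachable states.

open import Defs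
open import Data.Nat using (ℕ; suc; _*_; _^_; _≤_)
open import Data.List using (List; length)
open import Data.List.Relation.Unary.All using (All)
open import Data.List.Relation.Unary.Unique.Propositional using (Unique)
open import Data.Product using (∃₂)

open import Data.Nat using (zero; _+_; _∸_; _<_; _⊔_; z≤n; s≤s; _≟_; _<?_)
open import Data.Nat.Properties
open import Data.Bool using (Bool; true; false; if_then_else_)
import Data.Bool as Bool
open import Data.Maybe using (Maybe; just; nothing)
open import Data.Fin using (Fin)
import Data.Fin as Fin
open import Data.Fin.Properties using (any?; toℕ-injective; toℕ<n)
open import Data.Fin.Subset using (Subset; ∣_∣)
open import Data.Fin.Subset.Properties using (∣p∣≤n)
open import Data.Vec using (Vec; lookup; tabulate; []; _∷_)
import Data.Vec as Vec
open import Data.Vec.Properties using (tabulate∘lookup; tabulate-cong)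
import Data.List as List
open import Data.List using (map; foldr; allFin; upTo; _++_; cartesianProduct)
open import Data.List.Properties
  using (length-map; length-++; length-upTo; length-tabulate; length-removeAt′;
         map-tabulate; foldr-preservesᵇ)
import Data.List.Properties as Listₚ
open import Data.Nat.ListAction using (sum)
open import Data.List.Relation.Unary.Any using (here; there; index; _─_)
open import Data.List.Membership.Propositional using (_∈_)
open import Data.List.Membership.Propositional.Properties
  using (∈-map⁺; ∈-map⁻; ∈-++⁺ˡ; ∈-++⁺ʳ; ∈-allFin; ∈-upTo⁺; ∈-cartesianProduct⁺; foldr-selective)
open import Data.List.Relation.Unary.AllPairs using ([]; _∷_)
open import Data.List.Relation.Unary.All using ([]; _∷_)
import Data.List.Relation.Unary.All as All
import Data.List.Relation.Unary.All.Properties as All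
open import Data.Product using (_×_; _,_; proj₁)
open import Data.Sum using (inj₁; inj₂)
open import Data.Empty using (⊥-elim)
open import Function using (_∘_)
open import Relation.Nullary using (Dec; yes; no; does)
open import Relation.Nullary.Decidable using (_×-dec_; dec-true; dec-false)
open import Relation.Binary using (tri<; tri≈; tri>)
open import Relation.Binary.PropositionalEquality

∈-─⁺ : ∀ {A : Set} {x y : A} {ys : List A} (x∈ys : x ∈ ys) →
       y ∈ ys → y ≢ x → y ∈ (ys ─ x∈ys)
∈-─⁺ (here refl) (here refl)  y≢x = ⊥-elim (y≢x refl)
∈-─⁺ (here refl) (there y∈ys) _   = y∈ys
∈-─⁺ (there _)   (here refl)  _   = here refl
∈-─⁺ (there x∈ys) (there y∈ys) y≢x = there (∈-─⁺ x∈ys y∈ys y≢x)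

unique-⊆-length : ∀ {A : Set} {xs ys : List A} →
                  Unique xs → All (_∈ ys) xs → length xs ≤ length ys
unique-⊆-length {xs = List.[]} _ _ = z≤n
unique-⊆-length {xs = x List.∷ xs} {ys} (x∉xs ∷ xs!) (x∈ys ∷ xs⊆ys) = begin
  suc (length xs)          ≤⟨ s≤s (unique-⊆-length xs! xs⊆ys─x) ⟩
  suc (length (ys ─ x∈ys)) ≡⟨ sym (length-removeAt′ ys (index x∈ys)) ⟩
  length ys                ∎
  where
  open ≤-Reasoning
  xs⊆ys─x : All (_∈ (ys ─ x∈ys)) xs
  xs⊆ys─x = All.zipWith (λ (y∈ys , x≢y) → ∈-─⁺ x∈ys y∈ys (x≢y ∘ sym)) (xs⊆ys , x∉xs)

map-unique-on : ∀ {A B : Set} {P : A → Set} (f : A → B) →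
                (∀ {x y} → P x → P y → f x ≡ f y → x ≡ y) →
                ∀ {xs} → All P xs → Unique xs → Unique (map f xs)
map-unique-on f inj [] [] = []
map-unique-on f inj (px ∷ pxs) (x∉xs ∷ xs!) =
  All.map⁺ (All.zipWith (λ (py , x≢y) fx≡fy → x≢y (inj px py fx≡fy)) (pxs , x∉xs))
  ∷ map-unique-on f inj pxs xs!

count-by-code : ∀ {A B : Set} {P : A → Set} (code : A → B) (ys : List B) →
                (∀ {x y} → P x → P y → code x ≡ code y → x ≡ y) →
                (∀ {x} → P x → code x ∈ ys) →
                ∀ {xs} → Unique xs → All P xs → length xs ≤ length ys
count-by-code code ys inj into {xs} xs! pxs = begin
  length xs            ≡⟨ sym (length-map code xs) ⟩
  length (map code xs) ≤⟨ unique-⊆-length (map-unique-on code inj pxs xs!)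
                                           (All.map⁺ (All.map into pxs)) ⟩
  length ys            ∎
  where open ≤-Reasoning

length-cartesianProduct : ∀ {A B : Set} (xs : List A) (ys : List B) →
  length (cartesianProduct xs ys) ≡ length xs * length ys
length-cartesianProduct List.[] ys = refl
length-cartesianProduct (x List.∷ xs) ys = begin
  length (map (x ,_) ys ++ cartesianProduct xs ys)
    ≡⟨ length-++ (map (x ,_) ys) ⟩
  length (map (x ,_) ys) + length (cartesianProduct xs ys)
    ≡⟨ cong₂ _+_ (length-map (x ,_) ys) (length-cartesianProduct xs ys) ⟩
  length ys + length xs * length ys ∎
  where open ≡-Reasoning

incHead : ∀ {n} → Vec ℕ (suc n) → Vec ℕ (suc n)
incHead (x ∷ v) = suc x ∷ v

boundedVecs : (n s : ℕ) → List (Vec ℕ n)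
boundedVecs zero    s       = List.[ [] ]
boundedVecs (suc n) zero    = map (0 ∷_) (boundedVecs n zero)
boundedVecs (suc n) (suc s) =
  map (0 ∷_) (boundedVecs n (suc s)) ++ map incHead (boundedVecs (suc n) s)

∈-boundedVecs : ∀ {n} (v : Vec ℕ n) (s : ℕ) → Vec.sum v ≤ s → v ∈ boundedVecs n s
∈-boundedVecs []          s       _  = here refl
∈-boundedVecs (zero ∷ v)  zero    Σ≤ = ∈-map⁺ (0 ∷_) (∈-boundedVecs v zero Σ≤)
∈-boundedVecs (zero ∷ v)  (suc s) Σ≤ = ∈-++⁺ˡ (∈-map⁺ (0 ∷_) (∈-boundedVecs v (suc s) Σ≤))
∈-boundedVecs {suc n} (suc x ∷ v) (suc s) (s≤s Σ≤) =
  ∈-++⁺ʳ (map (0 ∷_) (boundedVecs n (suc s))) (∈-map⁺ incHead (∈-boundedVecs (x ∷ v) s Σ≤))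

-- The recursion is that of a binomial coefficient: at most C(n+s, s) ≤ 2^(n+s) vectors.
length-boundedVecs : (n s : ℕ) → length (boundedVecs n s) ≤ 2 ^ (n + s)
length-boundedVecs zero    s    = m^n>0 2 s
length-boundedVecs (suc n) zero = begin
  length (map (0 ∷_) (boundedVecs n zero)) ≡⟨ length-map _ (boundedVecs n zero) ⟩
  length (boundedVecs n zero)              ≤⟨ length-boundedVecs n zero ⟩
  2 ^ (n + 0)                              ≤⟨ m≤m+n _ _ ⟩
  2 ^ (suc n + 0)                          ∎
  where open ≤-Reasoning
length-boundedVecs (suc n) (suc s) = begin
  length (map (0 ∷_) (boundedVecs n (suc s)) ++ map incHead (boundedVecs (suc n) s))
    ≡⟨ length-++ (map (0 ∷_) (boundedVecs n (suc s))) ⟩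
  length (map (0 ∷_) (boundedVecs n (suc s))) + length (map incHead (boundedVecs (suc n) s))
    ≡⟨ cong₂ _+_ (length-map _ (boundedVecs n (suc s))) (length-map _ (boundedVecs (suc n) s)) ⟩
  length (boundedVecs n (suc s)) + length (boundedVecs (suc n) s)
    ≤⟨ +-mono-≤ (length-boundedVecs n (suc s)) (length-boundedVecs (suc n) s) ⟩
  2 ^ (n + suc s) + 2 ^ (suc n + s)
    ≡⟨ cong (λ m → 2 ^ (n + suc s) + 2 ^ m) (sym (+-suc n s)) ⟩
  2 ^ (n + suc s) + 2 ^ (n + suc s)
    ≡⟨ cong (2 ^ (n + suc s) +_) (sym (+-identityʳ _)) ⟩
  2 ^ (suc n + suc s) ∎
  where open ≤-Reasoning

∈⇒≤max : ∀ {x} (xs : List ℕ) → x ∈ xs → x ≤ foldr _⊔_ 0 xs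
∈⇒≤max (x List.∷ xs) (here refl)  = m≤m⊔n x _
∈⇒≤max (y List.∷ xs) (there x∈xs) = ≤-trans (∈⇒≤max xs x∈xs) (m≤n⊔m y _)

module _ {n : ℕ} (S : Subset n) where

  removedLabel : Fin n → ℕ
  removedLabel v = if lookup S v then 0 else label v

  removed≤lastRmvd : ∀ v → lookup S v ≡ false → label v ≤ lastRmvd S
  removed≤lastRmvd v v∉S =
    subst (_≤ lastRmvd S) (cong (λ b → if b then 0 else label v) v∉S)
      (∈⇒≤max (map removedLabel (allFin n)) (∈-map⁺ removedLabel (∈-allFin v)))

  lastRmvd-removed : ∀ v → label v ≡ lastRmvd S → lookup S v ≡ false
  lastRmvd-removed v v≡max with foldr-selective ⊔-sel 0 (map removedLabel (allFin n))
  ... | inj₁ max≡0 with () ← trans v≡max max≡0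
  ... | inj₂ max∈ with w , _ , max≡w ← ∈-map⁻ removedLabel max∈ with lookup S w in w∈?S
  ...   | true  with () ← trans v≡max max≡w
  ...   | false = subst (λ u → lookup S u ≡ false) w≡v w∈?S
    where
    w≡v : w ≡ v
    w≡v = toℕ-injective (suc-injective (sym (trans v≡max max≡w)))

  lastRmvd≤n : lastRmvd S ≤ n
  lastRmvd≤n = foldr-preservesᵇ {P = _≤ n} ⊔-lub z≤n (All.map⁺ (All.tabulate⁺ removedLabel≤n))
    where
    removedLabel≤n : ∀ v → removedLabel v ≤ n
    removedLabel≤n v with lookup S v
    ... | true  = z≤n
    ... | false = toℕ<n v

isBad? : ∀ {n} (S : Subset n) (δ : Vec ℕ n) (v : Fin n) → Dec (IsBad S δ v)
isBad? S δ v = (lookup S v Bool.≟ true) ×-dec ((label v <? lastRmvd S) ×-dec (lookup δ v ≟ 0))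

badVertex : ∀ {n} → Subset n → Vec ℕ n → Maybe (Fin n)
badVertex S δ with any? (isBad? S δ)
... | yes (v , _) = just v
... | no _        = nothing

badVertex-bad : ∀ {n} (S : Subset n) (δ : Vec ℕ n) {w} → badVertex S δ ≡ just w → IsBad S δ w
badVertex-bad S δ eq with any? (isBad? S δ)
badVertex-bad S δ refl | yes (_ , w-bad) = w-bad

badVertex-unique : ∀ {n} (S : Subset n) (δ : Vec ℕ n) →
                   (∀ u w → IsBad S δ u → IsBad S δ w → u ≡ w) →
                   ∀ {v} → IsBad S δ v → badVertex S δ ≡ just v
badVertex-unique S δ uniq v-bad with any? (isBad? S δ)
... | yes (u , u-bad) = cong just (uniq u _ u-bad v-bad)
... | no none         = ⊥-elim (none (_ , v-bad))

Code : ℕ → Set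
Code n = ℕ × Maybe (Fin n) × Vec ℕ n

encode : ∀ {n} → State n → Code n
encode (S , δ) = lastRmvd S , badVertex S δ , δ

marks : ∀ {n} → Maybe (Fin n) → Fin n → Bool
marks nothing  _ = false
marks (just w) v = does (w Fin.≟ v)

memberOf : ∀ {n} → Code n → Fin n → Bool
memberOf (L , b , δ) v with <-cmp (label v) L
... | tri> _ _ _ = true
... | tri≈ _ _ _ = false
... | tri< _ _ _ with lookup δ v
...   | suc _ = true
...   | zero  = marks b v

decode : ∀ {n} → Code n → State n
decode c@(_ , _ , δ) = tabulate (memberOf c) , δ

vertexOrNone : (n : ℕ) → List (Maybe (Fin n))
vertexOrNone n = nothing List.∷ map just (allFin n)

codes : (n : ℕ) → List (Code n)
codes n = cartesianProduct (upTo (suc n)) (cartesianProduct (vertexOrNone n) (boundedVecs n n))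

length-codes : ∀ n → length (codes n) ≤ suc n * (suc n * 2 ^ (n + n))
length-codes n = begin
  length (codes n)
    ≡⟨ length-cartesianProduct (upTo (suc n)) (cartesianProduct (vertexOrNone n) (boundedVecs n n)) ⟩
  length (upTo (suc n)) * length (cartesianProduct (vertexOrNone n) (boundedVecs n n))
    ≡⟨ cong₂ _*_ (length-upTo (suc n)) (length-cartesianProduct (vertexOrNone n) (boundedVecs n n)) ⟩
  suc n * (suc (length (map just (allFin n))) * length (boundedVecs n n))
    ≡⟨ cong (λ m → suc n * (suc m * length (boundedVecs n n))) length-vertices ⟩
  suc n * (suc n * length (boundedVecs n n))
    ≤⟨ *-monoʳ-≤ (suc n) (*-monoʳ-≤ (suc n) (length-boundedVecs n n)) ⟩
  suc n * (suc n * 2 ^ (n + n)) ∎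
  where
  open ≤-Reasoning
  length-vertices : length (map just (allFin n)) ≡ n
  length-vertices = trans (length-map just (allFin n)) (length-tabulate {n = n} (λ i → i))

sumOn-supported : ∀ {n} (S : Subset n) (δ : Vec ℕ n) →
                  (∀ v → lookup S v ≡ false → lookup δ v ≡ 0) → sumOn S δ ≡ Vec.sum δ
sumOn-supported {n} S δ supported = begin
  sum (map (λ v → if lookup S v then lookup δ v else 0) (allFin n))
    ≡⟨ cong sum (map-tabulate {n = n} (λ i → i) (λ v → if lookup S v then lookup δ v else 0)) ⟩
  sum (List.tabulate (λ v → if lookup S v then lookup δ v else 0))
    ≡⟨ cong sum (Listₚ.tabulate-cong on-S) ⟩
  sum (List.tabulate (lookup δ))
    ≡⟨ sum-tabulate δ ⟩
  Vec.sum δ ∎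
  where
  open ≡-Reasoning
  on-S : ∀ v → (if lookup S v then lookup δ v else 0) ≡ lookup δ v
  on-S v with lookup S v in v∈?S
  ... | true  = refl
  ... | false = sym (supported v v∈?S)
  sum-tabulate : ∀ {m} (d : Vec ℕ m) → sum (List.tabulate (lookup d)) ≡ Vec.sum d
  sum-tabulate []      = refl
  sum-tabulate (x ∷ d) = cong (x +_) (sum-tabulate d)

module _ {n : ℕ} {S : Subset n} {δ : Vec ℕ n} (reachable : Reachable n (S , δ)) where
  open Reachable reachable

  above-lastRmvd : ∀ v → lastRmvd S < label v → lookup S v ≡ true
  above-lastRmvd v max<v with lookup S v in v∈?S
  ... | true  = refl
  ... | false = ⊥-elim (<⇒≱ max<v (removed≤lastRmvd S v v∈?S))

  positive-in-S : ∀ v {k} → lookup δ v ≡ suc k → lookup S v ≡ true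
  positive-in-S v δv≡suc with lookup S v in v∈?S
  ... | true  = refl
  ... | false with () ← trans (sym δv≡suc) (δ-outside v v∈?S)

  marks-bad : ∀ v → label v < lastRmvd S → lookup δ v ≡ 0 →
              marks (badVertex S δ) v ≡ lookup S v
  marks-bad v v<max δv≡0 with lookup S v in v∈?S
  ... | true rewrite badVertex-unique S δ bad≤1 (v∈?S , v<max , δv≡0) =
          dec-true (v Fin.≟ v) refl
  ... | false with badVertex S δ in found
  ...   | nothing = refl
  ...   | just w  = dec-false (w Fin.≟ v) w≢v
    where
    w≢v : w ≢ v
    w≢v refl with () ← trans (sym (proj₁ (badVertex-bad S δ found))) v∈?S

  memberOf-encode : ∀ v → memberOf (encode (S , δ)) v ≡ lookup S v
  memberOf-encode v with <-cmp (label v) (lastRmvd S)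
  ... | tri> _ _ max<v = sym (above-lastRmvd v max<v)
  ... | tri≈ _ v≡max _ = sym (lastRmvd-removed S v v≡max)
  ... | tri< v<max _ _ with lookup δ v in δv
  ...   | suc _ = sym (positive-in-S v δv)
  ...   | zero  = marks-bad v v<max δv

  decode-encode : decode (encode (S , δ)) ≡ (S , δ)
  decode-encode = cong (_, δ) (trans (tabulate-cong memberOf-encode) (tabulate∘lookup S))

  sum≤n : Vec.sum δ ≤ n
  sum≤n = begin
    Vec.sum δ   ≡⟨ sym (sumOn-supported S δ δ-outside) ⟩
    sumOn S δ   ≡⟨ sumδ ⟩
    ∣ S ∣ ∸ 1   ≤⟨ m∸n≤m _ 1 ⟩
    ∣ S ∣       ≤⟨ ∣p∣≤n S ⟩
    n           ∎
    where open ≤-Reasoning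

  encode∈codes : encode (S , δ) ∈ codes n
  encode∈codes = ∈-cartesianProduct⁺ (∈-upTo⁺ (s≤s (lastRmvd≤n S)))
                   (∈-cartesianProduct⁺ bad∈ (∈-boundedVecs δ n sum≤n))
    where
    bad∈ : badVertex S δ ∈ vertexOrNone n
    bad∈ with badVertex S δ
    ... | nothing = here refl
    ... | just w  = there (∈-map⁺ just (∈-allFin w))

encode-injective : ∀ {n} {x y : State n} → Reachable n x → Reachable n y →
                   encode x ≡ encode y → x ≡ y
encode-injective rx ry eq =
  trans (sym (decode-encode rx)) (trans (cong decode eq) (decode-encode ry))

codes-bound : ∀ n → suc n * (suc n * 2 ^ (n + n)) ≡ 1 * suc n ^ 2 * 4 ^ n
codes-bound n = begin
  suc n * (suc n * 2 ^ (n + n)) ≡⟨ cong (λ m → suc n * (suc n * m)) 2^[n+n]≡4^n ⟩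
  suc n * (suc n * 4 ^ n)       ≡⟨ square-assoc (suc n) (4 ^ n) ⟩
  1 * suc n ^ 2 * 4 ^ n         ∎
  where
  open ≡-Reasoning
  square-assoc : ∀ a x → a * (a * x) ≡ 1 * a ^ 2 * x
  square-assoc a x = begin
    a * (a * x)     ≡⟨ sym (*-assoc a a x) ⟩
    a * a * x       ≡⟨ cong (λ m → a * m * x) (sym (*-identityʳ a)) ⟩
    a ^ 2 * x       ≡⟨ cong (_* x) (sym (*-identityˡ (a ^ 2))) ⟩
    1 * a ^ 2 * x   ∎
  2^[n+n]≡4^n : 2 ^ (n + n) ≡ 4 ^ n
  2^[n+n]≡4^n = trans (cong (λ m → 2 ^ (n + m)) (sym (+-identityʳ n))) (sym (^-*-assoc 2 2 n))

lemma14 : ∃₂ λ (c k : ℕ) → (n : ℕ) (xs : List (State n)) →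
    Unique xs → All (Reachable n) xs → length xs ≤ c * suc n ^ k * 4 ^ n
lemma14 = 1 , 2 , λ n xs xs! reachable → begin
  length xs                     ≤⟨ count-by-code encode (codes n) encode-injective
                                     encode∈codes xs! reachable ⟩
  length (codes n)              ≤⟨ length-codes n ⟩
  suc n * (suc n * 2 ^ (n + n)) ≡⟨ codes-bound n ⟩
  1 * suc n ^ 2 * 4 ^ n         ∎
  where open ≤-Reasoning
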